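{- Let $q$ be an odd prime power and let $\chi$ be the modified algebraic coloring of the complete graph on $\mathbb{F}_q^2$ defined in the context. If $a,b,c,d\in\mathbb{F}_q^2$ are distinct with $\chi(ab)=\chi(ac)$ and $\chi(db)=\chi(dc)$, then $a_1=d_1$.
   Context: Vertices are vectors $x=(x_1,x_2)\in\mathbb{F}_q^2$. For distinct $x,y$ let $\chi_1(xy)=(x_1y_1-x_2-y_2,\ \delta(x_1,y_1))$ with $\delta(x_1,y_1)=0$ if $x_1=y_1$ and $1$ otherwise (field operations in $\mathbb{F}_q$). For $\alpha\in\mathbb{F}_q$, the graph $G_\alpha$ on $\mathbb{F}_q\setminus\{\alpha\}$ with edges $\{x,y\}$, $x+y=2\alpha$, is a perfect matching; fix a partition $\mathbb{F}_q\setminus\{\alpha\}=S_\alpha\cup T_\alpha$ with each matching edge having one endpoint in each part, and for $\beta\ne\alpha$ let $f_\alpha(\beta)=S$ if $\beta\in S_\alpha$ and $T$ if $\beta\in T_\alpha$. Fix a linear order $<$ on $\mathbb{F}_q^2$. For $x<y$ with $x_1\ne y_1$ let $\chi_2(xy)=(f_{x_1}(y_1),f_{y_1}(x_1))$; when $x_1=y_1$, $\chi_2(xy)$ is some fixed value. Then $\chi(xy)=(\chi_1(xy),\chi_2(xy))$. -}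

module Defs where

open import Level using (0ℓ)
open import Data.Nat using (ℕ)
open import Data.Fin using (Fin)
import Data.Fin.Properties as FinP
open import Data.Bool using (Bool; true; false)
open import Data.Product using (_×_; _,_; ∃)
open import Relation.Nullary using (¬_; Dec; yes; no)
open import Relation.Binary using (Rel; Tri; tri<; tri≈; tri>)
open import Relation.Binary.Structures using (IsStrictTotalOrder)
open import Relation.Binary.PropositionalEquality using (_≡_; _≢_; refl; cong; sym; trans)
open import Relation.Binary.Definitions using (DecidableEquality)
open import Algebra.Core using (Op₁; Op₂)
open import Algebra.Structures using (IsCommutativeRing)
open import Function.Bundles using (_↔_; Inverse)

record FiniteField : Set₁ where
  infixl 7 _*_
  infixl 6 _+_ _-_
  field
    Carrier    : Set
    _+_ _*_    : Op₂ Carrier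
    -_         : Op₁ Carrier
    0# 1#      : Carrier
    isCommutativeRing : IsCommutativeRing _≡_ _+_ _*_ -_ 0# 1#
    0≢1        : 0# ≢ 1#
    inverse    : ∀ x → x ≢ 0# → ∃ λ y → x * y ≡ 1#
    size       : ℕ
    enum       : Carrier ↔ Fin size

  _-_ : Op₂ Carrier
  x - y = x + (- y)

  two : Carrier
  two = 1# + 1#

  _≟_ : DecidableEquality Carrier
  x ≟ y with Inverse.to enum x FinP.≟ Inverse.to enum y
  ... | yes p = yes (trans (sym (Inverse.strictlyInverseʳ enum x))
                  (trans (cong (Inverse.from enum) p) (Inverse.strictlyInverseʳ enum y)))
  ... | no ¬p = no λ e → ¬p (cong (Inverse.to enum) e)

module Coloring (F : FiniteField) where
  open FiniteField F

  Vertex : Set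
  Vertex = Carrier × Carrier

  -- Partition data: for each α, a map f α : F_q → Bool (true = S_α, false = T_α),
  -- only its values on F_q ∖ {α} matter.  Validity: each edge {β, 2α - β}
  -- (β ≠ α) of the matching G_α has one endpoint in each part.
  ValidPartition : (Carrier → Carrier → Bool) → Set
  ValidPartition f = ∀ α β → β ≢ α → f α β ≢ f α (two * α - β)

  δ : Carrier → Carrier → Bool
  δ x y with x ≟ y
  ... | yes _ = false
  ... | no _  = true

  χ₁ : Vertex → Vertex → Carrier × Bool
  χ₁ (x₁ , x₂) (y₁ , y₂) = (x₁ * y₁ - x₂ - y₂ , δ x₁ y₁)

  χ₂ : (f : Carrier → Carrier → Bool) → (_<_ : Rel Vertex 0ℓ) →
       IsStrictTotalOrder _≡_ _<_ → (c : Bool × Bool) →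
       Vertex → Vertex → Bool × Bool
  χ₂ f _<_ ord c (x₁ , x₂) (y₁ , y₂) with x₁ ≟ y₁
  ... | yes _ = c
  ... | no _ with IsStrictTotalOrder.compare ord (x₁ , x₂) (y₁ , y₂)
  ...   | tri< _ _ _ = (f x₁ y₁ , f y₁ x₁)
  ...   | tri≈ _ _ _ = c
  ...   | tri> _ _ _ = (f y₁ x₁ , f x₁ y₁)

  χ : (f : Carrier → Carrier → Bool) → (_<_ : Rel Vertex 0ℓ) →
      IsStrictTotalOrder _≡_ _<_ → (c : Bool × Bool) →
      Vertex → Vertex → (Carrier × Bool) × (Bool × Bool)
  χ f _<_ ord c x y = (χ₁ x y , χ₂ f _<_ ord c x y)

module Submission where

-- Writing
-- height x p = x·p₁ − p₂ for a point p = (p₁ , p₂), the first coordinate of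
-- χ₁(ab) is height a₁ b − a₂, so χ₁(ab) = χ₁(ac) says height a₁ b = height a₁ c,
-- i.e.  a₁·(b₁ − c₁) = b₂ − c₂ : the slope a₁ "sees" b and c at equal height.
-- Likewise d₁ does.  Subtracting, (a₁ − d₁)·(b₁ − c₁) = 0, so in a field
-- two distinct slopes a₁ ≠ d₁ would force b₁ = c₁ and then b₂ = c₂,
-- contradicting b ≠ c.  Hence a₁ = d₁ (equality in a finite field is decidable).

open import Defs
open import Level using (0ℓ)
open import Data.Nat using (_%_)
open import Data.Bool using (Bool)
open import Data.Product using (_×_; _,_; proj₁)
open import Data.Empty using (⊥-elim)
open import Relation.Nullary using (¬_; yes; no)
open import Relation.Binary using (Rel)
open import Relation.Binary.Structures using (IsStrictTotalOrder)
open import Relation.Binary.PropositionalEquality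
  using (_≡_; _≢_; cong; cong₂)
import Relation.Binary.PropositionalEquality as ≡
open import Algebra.Bundles using (CommutativeRing)
import Algebra.Definitions as AlgebraDefinitions
import Algebra.Properties.Ring as RingProperties
import Algebra.Properties.CommutativeSemigroup as CommutativeSemigroupProperties

module CommutativeRingFacts {c ℓ} (R : CommutativeRing c ℓ) where
  open CommutativeRing R
  open AlgebraDefinitions _≈_ using (AlmostLeftCancellative)
  open RingProperties ring
    using (+-cancelʳ; ⁻¹-anti-homo‿-; x∙y⁻¹≈ε⇒x≈y; x≈y⇒x∙y⁻¹≈ε;
           x[y-z]≈xy-xz; [y-z]x≈yx-zx)
  open CommutativeSemigroupProperties +-commutativeSemigroup
    using (xy∙z≈xz∙y; interchange)
  open import Relation.Binary.Reasoning.Setoid setoid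

  -- The height of the point p seen from slope x: p lies on the line
  -- p₂ = x·p₁ − height x p.
  height : Carrier → Carrier × Carrier → Carrier
  height x (p₁ , p₂) = x * p₁ - p₂

  -- A summand occurring in the same position on both sides cancels; this
  -- removes the common term −a₂ from an equality χ₁(ab) = χ₁(ac).
  cancel-middle : ∀ u u′ t v v′ → (u + t) + v ≈ (u′ + t) + v′ → u + v ≈ u′ + v′
  cancel-middle u u′ t v v′ e = +-cancelʳ t (u + v) (u′ + v′) (begin
    (u + v) + t     ≈⟨ xy∙z≈xz∙y u v t ⟩
    (u + t) + v     ≈⟨ e ⟩
    (u′ + t) + v′   ≈⟨ xy∙z≈xz∙y u′ t v′ ⟩
    (u′ + v′) + t   ∎)

  -- Both sides equal (u + z) − (v + w), rearranged; used for `difference-swap`.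
  difference-of-differences : ∀ u v w z → (u - v) - (w - z) ≈ (u - w) - (v - z)
  difference-of-differences u v w z = begin
    (u - v) - (w - z)       ≈⟨ +-congˡ (⁻¹-anti-homo‿- w z) ⟩
    (u - v) + (z - w)       ≈⟨ interchange u (- v) z (- w) ⟩
    (u + z) + (- v + - w)   ≈⟨ +-congˡ (+-comm (- v) (- w)) ⟩
    (u + z) + (- w + - v)   ≈⟨ interchange u (- w) z (- v) ⟨
    (u - w) + (z - v)       ≈⟨ +-congˡ (⁻¹-anti-homo‿- v z) ⟨
    (u - w) - (v - z)       ∎

  difference-swap : ∀ {u v w z} → u - v ≈ w - z → u - w ≈ v - z
  difference-swap {u} {v} {w} {z} e = x∙y⁻¹≈ε⇒x≈y (u - w) (v - z) (begin
    (u - w) - (v - z)   ≈⟨ difference-of-differences u v w z ⟨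
    (u - v) - (w - z)   ≈⟨ x≈y⇒x∙y⁻¹≈ε e ⟩
    0#                  ∎)

  equal-height⇒slope : ∀ x p₁ p₂ q₁ q₂ →
    height x (p₁ , p₂) ≈ height x (q₁ , q₂) → x * (p₁ - q₁) ≈ p₂ - q₂
  equal-height⇒slope x p₁ p₂ q₁ q₂ e =
    trans (x[y-z]≈xy-xz x p₁ q₁) (difference-swap e)

  module _ (cancel : AlmostLeftCancellative 0# _*_) where

    -- If two different slopes x ≠ y both satisfy s·δ = ε then δ = 0, since
    -- (x − y)·δ = 0 = (x − y)·0 and x − y is nonzero.
    common-slope⇒zero : ∀ {x y δ ε} → ¬ x ≈ y → x * δ ≈ ε → y * δ ≈ ε → δ ≈ 0#
    common-slope⇒zero {x} {y} {δ} {ε} x≉y xδ≈ε yδ≈ε =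
      cancel (x - y) δ 0# (λ x-y≈0 → x≉y (x∙y⁻¹≈ε⇒x≈y x y x-y≈0)) (begin
        (x - y) * δ     ≈⟨ [y-z]x≈yx-zx δ x y ⟩
        x * δ - y * δ   ≈⟨ x≈y⇒x∙y⁻¹≈ε (trans xδ≈ε (sym yδ≈ε)) ⟩
        0#              ≈⟨ zeroʳ (x - y) ⟨
        (x - y) * 0#    ∎)

    equal-height-at-two-slopes : ∀ {x y p₁ p₂ q₁ q₂} → ¬ x ≈ y →
      height x (p₁ , p₂) ≈ height x (q₁ , q₂) →
      height y (p₁ , p₂) ≈ height y (q₁ , q₂) →
      p₁ ≈ q₁ × p₂ ≈ q₂
    equal-height-at-two-slopes {x} {y} {p₁} {p₂} {q₁} {q₂} x≉y ex ey =
      x∙y⁻¹≈ε⇒x≈y p₁ q₁ δ≈0 , x∙y⁻¹≈ε⇒x≈y p₂ q₂ (begin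
        p₂ - q₂         ≈⟨ slope-x ⟨
        x * (p₁ - q₁)   ≈⟨ *-congˡ δ≈0 ⟩
        x * 0#          ≈⟨ zeroʳ x ⟩
        0#              ∎)
      where
      slope-x : x * (p₁ - q₁) ≈ p₂ - q₂
      slope-x = equal-height⇒slope x p₁ p₂ q₁ q₂ ex
      δ≈0 : p₁ - q₁ ≈ 0#
      δ≈0 = common-slope⇒zero x≉y slope-x (equal-height⇒slope y p₁ p₂ q₁ q₂ ey)

module FiniteFieldFacts (F : FiniteField) where
  open FiniteField F
  open AlgebraDefinitions (_≡_ {A = Carrier}) using (AlmostLeftCancellative)
  open ≡.≡-Reasoning

  commutativeRing : CommutativeRing 0ℓ 0ℓ
  commutativeRing = record { isCommutativeRing = isCommutativeRing }

  open CommutativeRing commutativeRing using (*-assoc; *-comm; *-identityˡ)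

  *-cancelˡ-nonzero : AlmostLeftCancellative 0# _*_
  *-cancelˡ-nonzero x y z x≢0 xy≡xz with inverse x x≢0
  ... | x⁻¹ , xx⁻¹≡1 = begin
    y               ≡⟨ *-identityˡ y ⟨
    1# * y          ≡⟨ cong (_* y) x⁻¹x≡1 ⟨
    x⁻¹ * x * y     ≡⟨ *-assoc x⁻¹ x y ⟩
    x⁻¹ * (x * y)   ≡⟨ cong (x⁻¹ *_) xy≡xz ⟩
    x⁻¹ * (x * z)   ≡⟨ *-assoc x⁻¹ x z ⟨
    x⁻¹ * x * z     ≡⟨ cong (_* z) x⁻¹x≡1 ⟩
    1# * z          ≡⟨ *-identityˡ z ⟩
    z               ∎
    where
    x⁻¹x≡1 : x⁻¹ * x ≡ 1#
    x⁻¹x≡1 = ≡.trans (*-comm x⁻¹ x) xx⁻¹≡1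

  open CommutativeRingFacts commutativeRing public
    using (height; cancel-middle)
  open CommutativeRingFacts commutativeRing
    using (equal-height-at-two-slopes)

  equal-height-at-two-slopes′ : ∀ {x y} {p q : Carrier × Carrier} → x ≢ y →
    height x p ≡ height x q → height y p ≡ height y q → p ≡ q
  equal-height-at-two-slopes′ x≢y ex ey
    with p₁≡q₁ , p₂≡q₂ ← equal-height-at-two-slopes *-cancelˡ-nonzero x≢y ex ey =
    cong₂ _,_ p₁≡q₁ p₂≡q₂

module ColoringFacts (F : FiniteField) where
  open FiniteField F
  open Coloring F
  open FiniteFieldFacts F

  χ₁-equal⇒equal-height : ∀ (a b c : Vertex) → χ₁ a b ≡ χ₁ a c →
    height (proj₁ a) b ≡ height (proj₁ a) c
  χ₁-equal⇒equal-height (a₁ , a₂) (b₁ , b₂) (c₁ , c₂) e =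
    cancel-middle (a₁ * b₁) (a₁ * c₁) (- a₂) (- b₂) (- c₂) (cong proj₁ e)

  same-first-coordinate : ∀ (a b c d : Vertex) → b ≢ c →
    χ₁ a b ≡ χ₁ a c → χ₁ d b ≡ χ₁ d c → proj₁ a ≡ proj₁ d
  same-first-coordinate a b c d b≢c eab edb with proj₁ a ≟ proj₁ d
  ... | yes a₁≡d₁ = a₁≡d₁
  ... | no a₁≢d₁ = ⊥-elim (b≢c (equal-height-at-two-slopes′ a₁≢d₁
                     (χ₁-equal⇒equal-height a b c eab)
                     (χ₁-equal⇒equal-height d b c edb)))

lemma12 : (F : FiniteField) → FiniteField.size F % 2 ≡ 1 →
    (f : FiniteField.Carrier F → FiniteField.Carrier F → Bool) →
    Coloring.ValidPartition F f →
    (_<_ : Rel (Coloring.Vertex F) 0ℓ) → (ord : IsStrictTotalOrder _≡_ _<_) →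
    (c : Bool × Bool) →
    (a b c' d : Coloring.Vertex F) →
    a ≢ b → a ≢ c' → a ≢ d → b ≢ c' → b ≢ d → c' ≢ d →
    Coloring.χ F f _<_ ord c a b ≡ Coloring.χ F f _<_ ord c a c' →
    Coloring.χ F f _<_ ord c d b ≡ Coloring.χ F f _<_ ord c d c' →
    proj₁ a ≡ proj₁ d
lemma12 F _ f _ _<_ ord c a b c' d _ _ _ b≢c' _ _ eab edb =
  ColoringFacts.same-first-coordinate F a b c' d b≢c' (cong proj₁ eab) (cong proj₁ edb)
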